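{- Let $G=(\Gamma,R,B)$ be a non-trivial chromatically invariant $2$-edge-coloured graph. If there exist graphs $\Gamma_1,\Gamma_2$ such that $\Gamma=\Gamma_1\vee\Gamma_2$ and neither $\Gamma_1$ nor $\Gamma_2$ is a join, then all joining edges of $\Gamma_1\vee\Gamma_2$ have the same colour in $G$.
   Context: All graphs are finite, simple, with nonempty vertex set. A graph $\Gamma$ is a join if $V(\Gamma)$ has a partition $\{X,Y\}$ into two nonempty sets with $xy\in E(\Gamma)$ for all $x\in X,y\in Y$; then $\Gamma=\Gamma[X]\vee\Gamma[Y]$, and edges with one end in $X$ and the other in $Y$ are joining edges. A $2$-edge-coloured graph is a triple $G=(\Gamma,R,B)$ with $R,B\subseteq E(\Gamma)$, $R\cap B=\emptyset$, $R\cup B=E(\Gamma)$ (red and blue edges). A $k$-colouring of $G$ is a proper vertex colouring $c:V(\Gamma)\to\{1,\dots,k\}$ of $\Gamma$ such that for every $ux\in R$ and $vy\in B$ (either endpoint may play the role of $u$, resp. $v$), $c(u)=c(v)$ implies $c(x)\ne c(y)$. $P(G,\lambda)$ is the polynomial whose value at each non-negative integer $k$ is the number of $k$-colourings of $G$. $G$ is chromatically invariant if $P(G,\lambda)=P(\Gamma,\lambda)$ (usual chromatic polynomial of $\Gamma$), and non-trivially so if also $R\ne\emptyset$ and $B\ne\emptyset$. -}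

module Defs where

open import Data.Nat using (ℕ; zero; suc)
open import Data.Bool using (Bool; true; false)
open import Data.Fin using (Fin)
import Data.Fin as F
open import Data.Fin.Properties using (all?)
open import Data.List using (List; []; _∷_; map; concatMap; filter; length; allFin)
import Data.Vec.Functional as VF
open import Data.Product using (Σ; ∃; _×_; _,_)
open import Relation.Nullary using (¬_; Dec)
open import Relation.Nullary.Decidable using (_→-dec_; ¬?)
open import Relation.Binary.PropositionalEquality using (_≡_; _≢_)
open import Data.Bool.Properties renaming (_≟_ to _≟ᵇ_)

record Graph (n : ℕ) : Set where
  field
    adj    : Fin n → Fin n → Bool
    sym    : ∀ u v → adj u v ≡ adj v u
    irrefl : ∀ u → adj u u ≡ false
open Graph public

-- A 2-edge-coloured graph: an edge uv is red iff red u v ≡ true, and blue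
-- iff red u v ≡ false (so R ∩ B = ∅ and R ∪ B = E automatically).
-- Values of red on non-edges are irrelevant.
record ECGraph (n : ℕ) : Set where
  field
    Γ       : Graph n
    red     : Fin n → Fin n → Bool
    red-sym : ∀ u v → red u v ≡ red v u
open ECGraph public

Edge : ∀ {n} → Graph n → Fin n → Fin n → Set
Edge Γ u v = adj Γ u v ≡ true

RedEdge : ∀ {n} → ECGraph n → Fin n → Fin n → Set
RedEdge G u v = (adj (Γ G) u v ≡ true) × (red G u v ≡ true)

BlueEdge : ∀ {n} → ECGraph n → Fin n → Fin n → Set
BlueEdge G u v = (adj (Γ G) u v ≡ true) × (red G u v ≡ false)

Proper : ∀ {n k} → Graph n → (Fin n → Fin k) → Set
Proper Γ c = ∀ u v → Edge Γ u v → c u ≢ c v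

Colouring : ∀ {n k} → ECGraph n → (Fin n → Fin k) → Set
Colouring G c = Proper (Γ G) c ×
  (∀ u x v y → RedEdge G u x → BlueEdge G v y → c u ≡ c v → c x ≢ c y)

proper? : ∀ {n k} (Γ : Graph n) (c : Fin n → Fin k) → Dec (Proper Γ c)
proper? Γ c = all? λ u → all? λ v →
  (adj Γ u v ≟ᵇ true) →-dec ¬? (c u F.≟ c v)

colouring? : ∀ {n k} (G : ECGraph n) (c : Fin n → Fin k) → Dec (Colouring G c)
colouring? G c = proper? (Γ G) c Relation.Nullary.×-dec
  (all? λ u → all? λ x → all? λ v → all? λ y →
    ((adj (Γ G) u x ≟ᵇ true) Relation.Nullary.×-dec (red G u x ≟ᵇ true)) →-dec
    ((adj (Γ G) v y ≟ᵇ true) Relation.Nullary.×-dec (red G v y ≟ᵇ false)) →-dec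
    (c u F.≟ c v) →-dec ¬? (c x F.≟ c y))

allFuns : ∀ n k → List (Fin n → Fin k)
allFuns zero k = (λ ()) ∷ []
allFuns (suc n) k = concatMap (λ i → map (λ f → i VF.∷ f) (allFuns n k)) (allFin k)

chromPoly : ∀ {n} → Graph n → ℕ → ℕ
chromPoly {n} Γ k = length (filter (proper? Γ) (allFuns n k))

ecChromPoly : ∀ {n} → ECGraph n → ℕ → ℕ
ecChromPoly {n} G k = length (filter (colouring? G) (allFuns n k))

-- Chromatic invariance: P(G,λ) = P(Γ,λ) as polynomials, i.e. equal values
-- at every non-negative integer k.
ChromInvariant : ∀ {n} → ECGraph n → Set
ChromInvariant G = ∀ k → ecChromPoly G k ≡ chromPoly (Γ G) k

NonTrivial : ∀ {n} → ECGraph n → Set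
NonTrivial G = (∃ λ u → ∃ λ v → RedEdge G u v) × (∃ λ u → ∃ λ v → BlueEdge G u v)

InducedIsJoin : ∀ {n} → Graph n → (Fin n → Bool) → Set
InducedIsJoin Γ S = Σ (Fin _ → Bool) λ T →
  (∀ v → T v ≡ true → S v ≡ true) ×
  (∃ λ x → T x ≡ true) ×
  (∃ λ y → (S y ≡ true) × (T y ≡ false)) ×
  (∀ x y → T x ≡ true → S y ≡ true → T y ≡ false → Edge Γ x y)

-- Γ = Γ[X] ∨ Γ[Y] where Y is the complement of X.
IsJoinPartition : ∀ {n} → Graph n → (Fin n → Bool) → Set
IsJoinPartition Γ X =
  (∃ λ x → X x ≡ true) × (∃ λ y → X y ≡ false) ×
  (∀ x y → X x ≡ true → X y ≡ false → Edge Γ x y)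

notB : Bool → Bool
notB true = false
notB false = true

module Submission where

-- Chromatic invariance says that the k-colourings of G
-- are exactly the proper k-colourings of Γ, since the former are a subset
-- of the latter and the two sets have the same size.  Now let p be adjacent
-- to two non-adjacent vertices a and b.  Merging b into a (giving
-- b the colour of a, every other vertex its own colour) is a proper
-- colouring of Γ, hence a colouring of G; as pa and pb then end in equal
-- colours at the common start p, they must carry the same edge colour.
-- Consequently, if p is adjacent to every vertex of a set S, splitting S
-- by the colour of the edge to p gives two parts with all edges between
-- them, so either this colour is constant on S or Γ[S] is a join.
-- The theorem applies this twice across the join Γ = Γ[X] ∨ Γ[Y]: from a
-- vertex of X towards Y, and from a vertex of Y towards X.

open import Defs hiding (sym)
open import Data.Nat using (ℕ; zero; suc)
open import Data.Bool using (Bool; true; false; _∧_)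
import Data.Bool as Bool
open import Data.Fin using (Fin)
import Data.Fin as Fin
open import Data.Product using (∃; _×_; _,_; proj₁; proj₂)
open import Data.Empty using (⊥-elim)
open import Data.List using (filter; length)
open import Data.List.Membership.Propositional using (_∈_)
open import Data.List.Membership.Propositional.Properties
  using (∈-filter⁺; ∈-filter⁻; ∈-allFin; ∈-map⁺; ∈-concatMap⁺)
import Data.List.Relation.Unary.Any as Any
open import Data.List.Relation.Binary.Pointwise using (Pointwise-≡⇒≡)
import Data.List.Relation.Binary.Pointwise.Properties as Pointwise
open import Data.List.Relation.Binary.Sublist.Heterogeneous.Properties
  using (⊆-filter-Sublist; toPointwise; fromPointwise)
import Data.Vec.Functional as Vec
open import Relation.Nullary using (¬_; yes; no; does)
open import Relation.Nullary.Decidable using (dec-true; dec-false)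
open import Relation.Unary using (Pred; Decidable)
open import Relation.Binary.PropositionalEquality
  using (_≡_; _≢_; _≗_; refl; sym; trans; subst; module ≡-Reasoning)

module _ {a p q} {A : Set a} {P : Pred A p} {Q : Pred A q}
         (P? : Decidable P) (Q? : Decidable Q) where

  filter-saturated : (∀ {x} → P x → Q x) →
                     ∀ {xs} → length (filter P? xs) ≡ length (filter Q? xs) →
                     ∀ {x} → x ∈ xs → Q x → P x
  filter-saturated P⇒Q {xs} same {x} x∈xs qx =
    proj₂ (∈-filter⁻ P? {xs = xs} (subst (x ∈_) (sym filters-equal) (∈-filter⁺ Q? x∈xs qx)))
    where
    filters-equal : filter P? xs ≡ filter Q? xs
    filters-equal = Pointwise-≡⇒≡ (toPointwise same
      (⊆-filter-Sublist P? Q? {as = xs} (λ { refl → P⇒Q }) (fromPointwise (Pointwise.refl refl))))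

-- Every function Fin n → Fin k occurs in allFuns n k, up to pointwise
-- equality (there is no function extensionality).
allFuns-complete : ∀ n k (c : Fin n → Fin k) → ∃ λ f → f ∈ allFuns n k × f ≗ c
allFuns-complete zero    k c = _ , Any.here refl , λ ()
allFuns-complete (suc n) k c =
  let f , f∈ , f≗ = allFuns-complete n k (λ i → c (Fin.suc i))
  in  c Fin.zero Vec.∷ f
    , ∈-concatMap⁺ _ (Any.map (λ { refl → ∈-map⁺ _ f∈ }) (∈-allFin (c Fin.zero)))
    , λ { Fin.zero → refl ; (Fin.suc i) → f≗ i }

module _ {N : ℕ} (Γ : Graph N) where

  edge⇒distinct : ∀ {u v} → Edge Γ u v → u ≢ v
  edge⇒distinct {u} e refl with trans (sym e) (irrefl Γ u)
  ... | ()

  non-edge : ∀ {u v} → adj Γ u v ≡ false → ¬ Edge Γ u v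
  non-edge ¬e e with trans (sym e) ¬e
  ... | ()

  proper-resp-≗ : ∀ {k} {c f : Fin N → Fin k} → f ≗ c → Proper Γ f → Proper Γ c
  proper-resp-≗ f≗c proper u v e same =
    proper u v e (trans (f≗c u) (trans same (sym (f≗c v))))

  merge : Fin N → Fin N → Fin N → Fin N
  merge a b w with w Fin.≟ b
  ... | yes _ = a
  ... | no  _ = w

  merge-source : ∀ a b → merge a b b ≡ a
  merge-source a b with b Fin.≟ b
  ... | yes _  = refl
  ... | no b≢b = ⊥-elim (b≢b refl)

  merge-target : ∀ a b → merge a b a ≡ a
  merge-target a b with a Fin.≟ b
  ... | yes _ = refl
  ... | no  _ = refl

  merge-proper : ∀ {a b} → adj Γ a b ≡ false → Proper Γ (merge a b)
  merge-proper {a} {b} ¬ab u v e same with u Fin.≟ b | v Fin.≟ b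
  ... | yes refl | yes refl = edge⇒distinct e refl
  ... | yes refl | no  _    = non-edge (trans (Graph.sym Γ b a) ¬ab) (subst (Edge Γ b) (sym same) e)
  ... | no  _    | yes refl = non-edge ¬ab (subst (λ w → Edge Γ w b) same e)
  ... | no  _    | no  _    = edge⇒distinct e same

module _ {N : ℕ} (G : ECGraph N) where

  colouring-resp-≗ : ∀ {k} {c f : Fin N → Fin k} → f ≗ c → Colouring G f → Colouring G c
  colouring-resp-≗ {c = c} {f} f≗c (proper , compatible) =
      proper-resp-≗ (Γ G) f≗c proper
    , (λ u x v y r b cu≡cv cx≡cy →
        compatible u x v y r b (transport u v cu≡cv) (transport x y cx≡cy))
    where
    transport : ∀ u v → c u ≡ c v → f u ≡ f v
    transport u v eq = trans (f≗c u) (trans eq (sym (f≗c v)))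

  -- Under chromatic invariance every proper colouring of Γ is a colouring
  -- of G: colourings form a subset of the proper colourings of equal size.
  proper⇒colouring : ChromInvariant G → ∀ {k} (c : Fin N → Fin k) →
                     Proper (Γ G) c → Colouring G c
  proper⇒colouring invariant {k} c c-proper with allFuns-complete N k c
  ... | f , f∈ , f≗c =
    colouring-resp-≗ f≗c
      (filter-saturated (colouring? G) (proper? (Γ G)) proj₁ (invariant k) f∈
        (proper-resp-≗ (Γ G) (λ v → sym (f≗c v)) c-proper))

  equal-ends⇒same-colour : ∀ {k} {c : Fin N → Fin k} → Colouring G c →
                           ∀ {p a b} → Edge (Γ G) p a → Edge (Γ G) p b →
                           c a ≡ c b → red G p a ≡ red G p b
  equal-ends⇒same-colour (_ , compatible) {p} {a} {b} pa pb ca≡cb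
    with red G p a in ra | red G p b in rb
  ... | true  | true  = refl
  ... | false | false = refl
  ... | true  | false = ⊥-elim (compatible p a p b (pa , ra) (pb , rb) refl ca≡cb)
  ... | false | true  = ⊥-elim (compatible p b p a (pb , rb) (pa , ra) refl (sym ca≡cb))

  -- Two non-adjacent neighbours of p are joined to p by edges of the same
  -- colour: colour them alike by merging one into the other.
  common-neighbours-same-colour : ChromInvariant G → ∀ {p a b} →
    Edge (Γ G) p a → Edge (Γ G) p b → adj (Γ G) a b ≡ false → red G p a ≡ red G p b
  common-neighbours-same-colour invariant {a = a} {b} pa pb ¬ab =
    equal-ends⇒same-colour
      (proper⇒colouring invariant (merge (Γ G) a b) (merge-proper (Γ G) ¬ab)) pa pb
      (trans (merge-target (Γ G) a b) (sym (merge-source (Γ G) a b)))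

restrict : ∀ {n q} {Q : Pred (Fin n) q} → (Fin n → Bool) → Decidable Q → Fin n → Bool
restrict S Q? v = S v ∧ does (Q? v)

module _ {n q} {Q : Pred (Fin n) q} (S : Fin n → Bool) (Q? : Decidable Q) where

  restrict-⊆ : ∀ v → restrict S Q? v ≡ true → S v ≡ true
  restrict-⊆ v with S v
  ... | true  = λ _ → refl
  ... | false = λ ()

  restrict-holds : ∀ v → restrict S Q? v ≡ true → Q v
  restrict-holds v with S v | Q? v
  ... | true  | yes qv = λ _ → qv
  ... | true  | no  _  = λ ()
  ... | false | _      = λ ()

  restrict-intro : ∀ {v} → S v ≡ true → Q v → restrict S Q? v ≡ true
  restrict-intro {v} Sv qv rewrite Sv = dec-true (Q? v) qv

  restrict-reject : ∀ {v} → S v ≡ true → ¬ Q v → restrict S Q? v ≡ false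
  restrict-reject {v} Sv ¬qv rewrite Sv = dec-false (Q? v) ¬qv

-- If p is adjacent to every vertex of S and Γ[S] is not a join, all edges
-- from p to S have the same colour: otherwise the vertices s ∈ S with
-- red p s = red p a and the remaining ones would form a join of Γ[S].
constant-towards-non-join : ∀ {N} (G : ECGraph N) → ChromInvariant G →
  (S : Fin N → Bool) (p : Fin N) → (∀ s → S s ≡ true → Edge (Γ G) p s) →
  ¬ InducedIsJoin (Γ G) S →
  ∀ {a b} → S a ≡ true → S b ≡ true → red G p a ≡ red G p b
constant-towards-non-join G invariant S p p~S not-join {a} {b} Sa Sb
  with red G p a Bool.≟ red G p b
... | yes same  = same
... | no differ = ⊥-elim (not-join
      ( T , restrict-⊆ S Q? , (a , restrict-intro S Q? Sa refl)
      , (b , Sb , restrict-reject S Q? Sb (λ eq → differ (sym eq))) , joined ))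
  where
  Q : Fin _ → Set
  Q v = red G p v ≡ red G p a
  Q? : Decidable Q
  Q? v = red G p v Bool.≟ red G p a
  T : Fin _ → Bool
  T = restrict S Q?

  agrees : ∀ t s → T t ≡ true → S s ≡ true → adj (Γ G) t s ≡ false → Q s
  agrees t s Tt Ss ¬ts =
    trans (sym (common-neighbours-same-colour G invariant
                  (p~S t (restrict-⊆ S Q? t Tt)) (p~S s Ss) ¬ts))
          (restrict-holds S Q? t Tt)

  joined : ∀ t s → T t ≡ true → S s ≡ true → T s ≡ false → Edge (Γ G) t s
  joined t s Tt Ss ¬Ts with adj (Γ G) t s in ts
  ... | true  = refl
  ... | false with trans (sym (restrict-intro S Q? Ss (agrees t s Tt Ss ts))) ¬Ts
  ...   | ()

notB-true : ∀ {b} → notB b ≡ true → b ≡ false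
notB-true {false} _ = refl

notB-false : ∀ {b} → b ≡ false → notB b ≡ true
notB-false refl = refl

-- Across the join Γ[X] ∨ Γ[Y] (Y the complement of X): a vertex of X sees
-- all of Y in one colour, a vertex of Y sees all of X in one colour, and
-- the two statements chain together through any joining edge x y′.
lemma11 : (n : ℕ) (G : ECGraph (suc n)) → NonTrivial G → ChromInvariant G →
    (X : Fin (suc n) → Bool) → IsJoinPartition (Γ G) X →
    ¬ InducedIsJoin (Γ G) X → ¬ InducedIsJoin (Γ G) (λ v → notB (X v)) →
    ∀ x y x′ y′ → X x ≡ true → X y ≡ false → X x′ ≡ true → X y′ ≡ false →
    red G x y ≡ red G x′ y′
lemma11 n G _ invariant X (_ , _ , join) X-not-join Y-not-join x y x′ y′ Xx Xy Xx′ Xy′ =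
  begin
    red G x y    ≡⟨ constant-towards-non-join G invariant Y x x~Y Y-not-join
                      (notB-false Xy) (notB-false Xy′) ⟩
    red G x y′   ≡⟨ red-sym G x y′ ⟩
    red G y′ x   ≡⟨ constant-towards-non-join G invariant X y′ y′~X X-not-join Xx Xx′ ⟩
    red G y′ x′  ≡⟨ red-sym G y′ x′ ⟩
    red G x′ y′  ∎
  where
  open ≡-Reasoning
  Y : Fin (suc n) → Bool
  Y v = notB (X v)
  x~Y : ∀ s → Y s ≡ true → Edge (Γ G) x s
  x~Y s Ys = join x s Xx (notB-true Ys)
  y′~X : ∀ s → X s ≡ true → Edge (Γ G) y′ s
  y′~X s Xs = trans (Graph.sym (Γ G) y′ s) (join s y′ Xs Xy′)
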